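{- If $G$ is a bipartite graph, then $\chi^{c}_i(G)=2\Delta(G)$.
   Context: An incidence of a graph $G$ is a pair $(v,e)$ where $v$ is a vertex and $e$ an edge incident with $v$. For a vertex $w$, let $I(w)$ be the set of all incidences $(u,e)$ such that $e$ is incident with $w$. Two incidences conflict if both lie in $I(w)$ for some vertex $w$. A conflict-free incidence $k$-coloring assigns colors from a $k$-element set to the incidences so that conflicting incidences get distinct colors; $\chi^{c}_i(G)$ is the least such $k$. $\Delta(G)$ denotes the maximum degree. Graphs are finite. -}

module Defs where

open import Data.Nat using (ℕ; _⊔_; _*_; _≤_)
open import Data.Bool using (Bool; true; false; T; T?)
open import Data.Fin using (Fin)
open import Data.List using (List; length; filter; map; foldr)
open import Data.List using (allFin) public
open import Data.Product using (Σ; _×_; _,_; proj₁; ∃-syntax)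
open import Data.Sum using (_⊎_)
open import Relation.Binary.PropositionalEquality using (_≡_; _≢_)

record Graph : Set where
  field
    n     : ℕ
    adj   : Fin n → Fin n → Bool
    sym   : ∀ u v → adj u v ≡ adj v u
    irref : ∀ v → adj v v ≡ false
open Graph public

degree : (G : Graph) → Fin (n G) → ℕ
degree G v = length (filter (λ w → T? (adj G v w)) (allFin (n G)))

Δ : Graph → ℕ
Δ G = foldr _⊔_ 0 (map (degree G) (allFin (n G)))

Bipartite : Graph → Set
Bipartite G = Σ (Fin (n G) → Bool) λ f → ∀ u v → T (adj G u v) → f u ≢ f v

-- An incidence (v, e) with e = {v, w} is represented by the ordered
-- pair (v , w) of adjacent vertices.
Incidence : Graph → Set
Incidence G = Σ (Fin (n G) × Fin (n G)) λ p → T (adj G (proj₁ p) (Data.Product.proj₂ p))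

-- (v, {v,w}) ∈ I(x)  iff  the edge {v,w} is incident with x
InI : (G : Graph) → Fin (n G) → Incidence G → Set
InI G x ((v , w) , _) = (x ≡ v) ⊎ (x ≡ w)

Conflict : (G : Graph) → Incidence G → Incidence G → Set
Conflict G i j = ∃[ x ] (InI G x i × InI G x j)

IsCFIncColoring : (G : Graph) (k : ℕ) → (Incidence G → Fin k) → Set
IsCFIncColoring G k c =
  ∀ i j → proj₁ i ≢ proj₁ j → Conflict G i j → c i ≢ c j

ChiCI≡ : Graph → ℕ → Set
ChiCI≡ G m =
  (Σ (Incidence G → Fin m) (IsCFIncColoring G m))
  × (∀ k (c : Incidence G → Fin k) → IsCFIncColoring G k c → m ≤ k)

{-# OPTIONS --safe #-}
-- The 2·deg(x) incidences (x, xw) and (w, xw) for the neighbours w of x all lie in I(x), so a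
-- conflict-free incidence colouring gives them distinct colours: at least 2Δ colours are needed.
-- Conversely, a bipartite graph has a proper edge colouring with Δ colours (Kőnig): colour the edges
-- one by one; if the ends u, v of an uncoloured edge miss colours a ≠ b, swap a and b along the
-- a/b-alternating path from v, which by bipartiteness cannot reach u, so afterwards both miss a.
-- Colouring the incidence (v, vw) by the pair (side of v, colour of vw) then uses 2Δ colours, and
-- two conflicting incidences with equal colours would lie on equally coloured edges sharing a
-- vertex, hence on one edge, and at ends on the same side of it, hence be equal.
module Submission where

open import Defs hiding (sym)
open import Data.Bool using (Bool; true; false; not; T; T?; _xor_)
open import Data.Bool.Properties using (¬-not; not-distribˡ-xor; xor-same)
open import Data.Empty using (⊥)
open import Data.Fin using (Fin; zero; suc; toℕ; fromℕ<; combine; remQuot; _≟_)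
open import Data.Fin.Permutation.Components using (transpose; transpose-inverse)
open import Data.Fin.Properties using (combine-injective; any?; all?; ¬∀⟶∃¬; injective⇒≤; toℕ-injective; toℕ-fromℕ<; toℕ≤pred[n]; *↔×; 2↔Bool)
open import Data.List using (List; []; _∷_; lookup; filter; map; cartesianProduct)
open import Data.List.Membership.Propositional using (_∈_)
open import Data.List.Membership.Propositional.Properties using (∈-filter⁺; ∈-filter⁻; ∈-allFin; ∈-lookup; ∈-map⁺; ∈-map⁻; foldr-selective; ∈-cartesianProductWith⁺)
open import Data.List.Properties using (foldr-preservesᵒ)
import Data.List.Relation.Unary.All as All
open import Data.List.Relation.Unary.Any as Any using (here; there)
open import Data.List.Relation.Unary.Any.Properties using (lookup-index)
open import Data.List.Relation.Unary.Unique.Propositional using (Unique; _∷_)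
open import Data.List.Relation.Unary.Unique.Propositional.Properties using (filter⁺; allFin⁺)
open import Data.Maybe using (Maybe; just; nothing; _>>=_)
import Data.Maybe as Maybe
open import Data.Maybe.Properties using (just-injective; ≡-dec)
open import Data.Nat using (ℕ; zero; suc; _*_; _≤_; _<_; _≤′_; ≤′-refl; ≤′-step; s≤s; z≤n)
open import Data.Nat.Properties using (⊔-sel; m≤n⇒m≤n⊔o; m≤n⇒m≤o⊔n; ≤-reflexive; <⇒≱; ≤⇒≤′)
open import Data.Product using (Σ; _×_; _,_; proj₁; proj₂; ∃; ∃-syntax)
open import Data.Sum using (_⊎_; inj₁; inj₂; [_,_])
open import Function using (_∘_; id; Injective)
open import Function.Bundles using (Injection; Inverse)
open import Function.Properties.Inverse using (↔⇒↣; ↔-sym)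
open import Relation.Binary using (Decidable)
open import Relation.Binary.PropositionalEquality using (_≡_; _≢_; refl; sym; trans; cong; subst; module ≡-Reasoning)
open import Relation.Nullary using (¬_; Dec; yes; no; ¬?; contradiction; _×-dec_; _⊎-dec_)
open import Relation.Nullary.Decidable using (decidable-stable; map′)

private variable
  A : Set
  m k : ℕ

lookup-injective : {xs : List A} → Unique xs → Injective _≡_ _≡_ (lookup xs)
lookup-injective (_ ∷ _) {zero} {zero} _ = refl
lookup-injective (x∉xs ∷ _) {zero} {suc j} eq = contradiction eq (All.lookup x∉xs (∈-lookup j))
lookup-injective (x∉xs ∷ _) {suc i} {zero} eq = contradiction (sym eq) (All.lookup x∉xs (∈-lookup i))
lookup-injective (_ ∷ xs-unique) {suc i} {suc j} eq = cong suc (lookup-injective xs-unique eq)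

remQuot-injective : (n : ℕ) → Injective _≡_ _≡_ (remQuot {m} n)
remQuot-injective n = Injection.injective (↔⇒↣ *↔×)

fromBool : Bool → Fin 2
fromBool = Inverse.from 2↔Bool

fromBool-injective : Injective _≡_ _≡_ fromBool
fromBool-injective = Injection.injective (↔⇒↣ (↔-sym 2↔Bool))

transpose-matchʳ : ∀ {n} (i j : Fin n) → transpose i j j ≡ i
transpose-matchʳ i j with j ≟ i
... | yes j≡i = j≡i
... | no _ with j ≟ j
...   | yes _ = refl
...   | no j≢j = contradiction refl j≢j

transpose-fix : ∀ {n} {i j l : Fin n} → l ≢ i → l ≢ j → transpose i j l ≡ l
transpose-fix {i = i} {j} {l} l≢i l≢j with l ≟ i
... | yes l≡i = contradiction l≡i l≢i
... | no _ with l ≟ j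
...   | yes l≡j = contradiction l≡j l≢j
...   | no _ = refl

transpose-injective : ∀ {n} (i j : Fin n) → Injective _≡_ _≡_ (transpose i j)
transpose-injective i j {x} {y} eq = begin
  x                               ≡⟨ sym (transpose-inverse j i) ⟩
  transpose j i (transpose i j x) ≡⟨ cong (transpose j i) eq ⟩
  transpose j i (transpose i j y) ≡⟨ transpose-inverse j i ⟩
  y                               ∎
  where open ≡-Reasoning

transpose[l]≡i⇒l≡j : ∀ {n} {i j l : Fin n} → transpose i j l ≡ i → l ≡ j
transpose[l]≡i⇒l≡j {i = i} {j} eq = transpose-injective i j (trans eq (sym (transpose-matchʳ i j)))

module _ (G : Graph) where

  Vertex : Set
  Vertex = Fin (n G)

  Adj : Vertex → Vertex → Set
  Adj u v = T (adj G u v)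

  private variable
    u v w x y z : Vertex

  adjacent? : Decidable Adj
  adjacent? u v = T? (adj G u v)

  adj-sym : Adj u v → Adj v u
  adj-sym {u} {v} = subst T (Graph.sym G u v)

  adj⇒≢ : Adj u v → u ≢ v
  adj⇒≢ {u} uu refl = subst T (irref G u) uu

  neighbours : Vertex → List Vertex
  neighbours x = filter (adjacent? x) (allFin (n G))

  neighbour : (x : Vertex) → Fin (degree G x) → Vertex
  neighbour x = lookup (neighbours x)

  neighbour-adj : ∀ x i → Adj x (neighbour x i)
  neighbour-adj x i = proj₂ (∈-filter⁻ (adjacent? x) {xs = allFin (n G)} (∈-lookup i))

  neighbour-injective : ∀ x → Injective _≡_ _≡_ (neighbour x)
  neighbour-injective x = lookup-injective (filter⁺ (adjacent? x) (allFin⁺ (n G)))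

  neighbourIndex : Adj x w → Fin (degree G x)
  neighbourIndex {x} {w} xw = Any.index (∈-filter⁺ (adjacent? x) (∈-allFin w) xw)

  neighbour-index : (xw : Adj x w) → neighbour x (neighbourIndex xw) ≡ w
  neighbour-index {x} {w} xw = sym (lookup-index (∈-filter⁺ (adjacent? x) (∈-allFin w) xw))

  injection⇒≤degree : (t : Fin m → Vertex) → Injective _≡_ _≡_ t → (∀ i → Adj x (t i)) → m ≤ degree G x
  injection⇒≤degree {x = x} t t-injective x-t = injective⇒≤ λ {i} {j} eq → t-injective (begin
    t i                                 ≡⟨ sym (neighbour-index (x-t i)) ⟩
    neighbour x (neighbourIndex (x-t i)) ≡⟨ cong (neighbour x) eq ⟩
    neighbour x (neighbourIndex (x-t j)) ≡⟨ neighbour-index (x-t j) ⟩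
    t j                                 ∎)
    where open ≡-Reasoning

  degree≤Δ : ∀ x → degree G x ≤ Δ G
  degree≤Δ x = foldr-preservesᵒ
    (λ d e → [ m≤n⇒m≤n⊔o e , m≤n⇒m≤o⊔n d ]) 0 (map (degree G) (allFin (n G)))
    (inj₂ (Any.map ≤-reflexive (∈-map⁺ (degree G) (∈-allFin x))))

  Δ-attained : Δ G ≡ 0 ⊎ ∃[ x ] Δ G ≡ degree G x
  Δ-attained with foldr-selective ⊔-sel 0 (map (degree G) (allFin (n G)))
  ... | inj₁ Δ≡0 = inj₁ Δ≡0
  ... | inj₂ Δ∈ = let x , _ , Δ≡deg = ∈-map⁻ (degree G) Δ∈ in inj₂ (x , Δ≡deg)

  -- The lower bound

  conflicting-family⇒≤ : (c : Incidence G → Fin k) → IsCFIncColoring G k c →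
                         (t : Fin m → Incidence G) → (∀ i → InI G x (t i)) →
                         Injective _≡_ _≡_ (proj₁ ∘ t) → m ≤ k
  conflicting-family⇒≤ {x = x} c cf t x∈t t-injective = injective⇒≤ λ {i} {j} same-colour →
    decidable-stable (i ≟ j) λ i≢j →
      cf (t i) (t j) (i≢j ∘ t-injective) (x , x∈t i , x∈t j) same-colour

  incidenceAt : (x : Vertex) → Fin 2 × Fin (degree G x) → Incidence G
  incidenceAt x (zero , i)     = (x , neighbour x i) , neighbour-adj x i
  incidenceAt x (suc zero , i) = (neighbour x i , x) , adj-sym (neighbour-adj x i)

  incidenceAt∈I : ∀ x p → InI G x (incidenceAt x p)
  incidenceAt∈I x (zero , i)     = inj₁ refl
  incidenceAt∈I x (suc zero , i) = inj₂ refl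

  incidenceAt-injective : ∀ x → Injective _≡_ _≡_ (proj₁ ∘ incidenceAt x)
  incidenceAt-injective x {zero , i} {zero , j} eq = cong (zero ,_) (neighbour-injective x (cong proj₂ eq))
  incidenceAt-injective x {zero , i} {suc zero , j} eq = contradiction (cong proj₁ eq) (adj⇒≢ (neighbour-adj x j))
  incidenceAt-injective x {suc zero , i} {zero , j} eq = contradiction (sym (cong proj₁ eq)) (adj⇒≢ (neighbour-adj x i))
  incidenceAt-injective x {suc zero , i} {suc zero , j} eq = cong (suc zero ,_) (neighbour-injective x (cong proj₁ eq))

  conflictFree⇒2*degree≤ : (c : Incidence G → Fin k) → IsCFIncColoring G k c → ∀ x → 2 * degree G x ≤ k
  conflictFree⇒2*degree≤ c cf x = conflicting-family⇒≤ c cf (incidenceAt x ∘ remQuot (degree G x))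
    (incidenceAt∈I x ∘ remQuot (degree G x))
    (remQuot-injective (degree G x) ∘ incidenceAt-injective x)

  conflictFree⇒2*Δ≤ : (c : Incidence G → Fin k) → IsCFIncColoring G k c → 2 * Δ G ≤ k
  conflictFree⇒2*Δ≤ c cf with Δ-attained
  ... | inj₁ Δ≡0 rewrite Δ≡0 = z≤n
  ... | inj₂ (x , Δ≡deg) rewrite Δ≡deg = conflictFree⇒2*degree≤ c cf x

  -- Kőnig's edge-colouring theorem

  module EdgeColouring (K : ℕ) where

    record PartialColouring : Set where
      field
        colour           : Vertex → Vertex → Maybe (Fin K)
        colour-sym       : ∀ y z → colour y z ≡ colour z y
        colour⇒adj       : ∀ {y z c} → colour y z ≡ just c → Adj y z
        colour-injective : ∀ {y z w c} → colour y z ≡ just c → colour y w ≡ just c → z ≡ w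
    open PartialColouring public

    Coloured : PartialColouring → Vertex → Vertex → Set
    Coloured P y z = ∃[ c ] colour P y z ≡ just c

    Total : PartialColouring → Set
    Total P = ∀ {y z} → Adj y z → Coloured P y z

    Missing : PartialColouring → Vertex → Fin K → Set
    Missing P y c = ∀ w → colour P y w ≢ just c

    _⊑_ : PartialColouring → PartialColouring → Set
    P ⊑ Q = ∀ {y z} → Coloured P y z → Coloured Q y z

    Extension : PartialColouring → Vertex → Vertex → Set
    Extension P u v = Σ PartialColouring λ Q → P ⊑ Q × Coloured Q u v

    private variable
      P : PartialColouring
      a b c : Fin K

    _≟ᶜ_ : (c d : Maybe (Fin K)) → Dec (c ≡ d)
    _≟ᶜ_ = ≡-dec _≟_

    uncoloured : PartialColouring
    uncoloured = record
      { colour           = λ _ _ → nothing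
      ; colour-sym       = λ _ _ → refl
      ; colour⇒adj       = λ ()
      ; colour-injective = λ ()
      }

    colourNeighbour : PartialColouring → Vertex → Fin K → Maybe Vertex
    colourNeighbour P y c with any? (λ w → colour P y w ≟ᶜ just c)
    ... | yes (w , _) = just w
    ... | no _        = nothing

    colourNeighbour-sound : colourNeighbour P y c ≡ just w → colour P y w ≡ just c
    colourNeighbour-sound {P} {y} {c} eq with any? (λ w → colour P y w ≟ᶜ just c)
    colourNeighbour-sound refl | yes (_ , yw) = yw

    colourNeighbour-complete : colour P y w ≡ just c → colourNeighbour P y c ≡ just w
    colourNeighbour-complete {P} {y} {w} {c} yw with any? (λ w → colour P y w ≟ᶜ just c)
    ... | yes (w′ , yw′) = cong just (colour-injective P yw′ yw)
    ... | no none        = contradiction (w , yw) none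

    missing? : ∀ P y c → Dec (Missing P y c)
    missing? P y c = all? (λ w → ¬? (colour P y w ≟ᶜ just c))

    -- If no colour were missing at u, the edges at u of all K colours together with the uncoloured
    -- edge uv would give u at least K + 1 neighbours.
    missing-colour : (P : PartialColouring) → degree G u ≤ K → Adj u v → colour P u v ≡ nothing → ∃ (Missing P u)
    missing-colour {u} {v} P deg≤K uv uv-uncoloured with any? (missing? P u)
    ... | yes missing = missing
    ... | no none = contradiction (injection⇒≤degree target target-injective target-adj) (<⇒≱ (s≤s deg≤K))
      where
        present : ∀ c → ∃[ w ] colour P u w ≡ just c
        present c =
          let w , ¬¬uw = ¬∀⟶∃¬ (n G) _ (λ w → ¬? (colour P u w ≟ᶜ just c)) (λ missing → none (c , missing))
          in w , decidable-stable (colour P u w ≟ᶜ just c) ¬¬uw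

        target : Fin (suc K) → Vertex
        target zero    = v
        target (suc c) = proj₁ (present c)

        target-adj : ∀ i → Adj u (target i)
        target-adj zero    = uv
        target-adj (suc c) = colour⇒adj P (proj₂ (present c))

        target-injective : Injective _≡_ _≡_ target
        target-injective {zero} {zero} _ = refl
        target-injective {zero} {suc d} refl with () ← trans (sym uv-uncoloured) (proj₂ (present d))
        target-injective {suc c} {zero} refl with () ← trans (sym uv-uncoloured) (proj₂ (present c))
        target-injective {suc c} {suc d} eq = cong suc (just-injective (begin
          just c                        ≡⟨ sym (proj₂ (present c)) ⟩
          colour P u (target (suc c))   ≡⟨ cong (colour P u) eq ⟩
          colour P u (target (suc d))   ≡⟨ proj₂ (present d) ⟩
          just d                        ∎))
          where open ≡-Reasoning

    module _ (P : PartialColouring) (uv : Adj u v) (u-misses : Missing P u a) (v-misses : Missing P v a) where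
      private
        IsUV : Vertex → Vertex → Set
        IsUV y z = (y ≡ u × z ≡ v) ⊎ (y ≡ v × z ≡ u)

        isUV? : Decidable IsUV
        isUV? y z = (y ≟ u ×-dec z ≟ v) ⊎-dec (y ≟ v ×-dec z ≟ u)

        isUV-sym : IsUV y z → IsUV z y
        isUV-sym (inj₁ (y≡u , z≡v)) = inj₂ (z≡v , y≡u)
        isUV-sym (inj₂ (y≡v , z≡u)) = inj₁ (z≡u , y≡v)

        isUV⇒misses : IsUV y z → Missing P y a
        isUV⇒misses (inj₁ (refl , _)) = u-misses
        isUV⇒misses (inj₂ (refl , _)) = v-misses

        colour′ : Vertex → Vertex → Maybe (Fin K)
        colour′ y z with isUV? y z
        ... | yes _ = just a
        ... | no _  = colour P y z

        colour′-sym : ∀ y z → colour′ y z ≡ colour′ z y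
        colour′-sym y z with isUV? y z | isUV? z y
        ... | yes _    | yes _    = refl
        ... | no _     | no _     = colour-sym P y z
        ... | yes yz   | no ¬zy   = contradiction (isUV-sym yz) ¬zy
        ... | no ¬yz   | yes zy   = contradiction (isUV-sym zy) ¬yz

        colour′⇒adj : colour′ y z ≡ just c → Adj y z
        colour′⇒adj {y} {z} eq with isUV? y z
        ... | yes (inj₁ (refl , refl)) = uv
        ... | yes (inj₂ (refl , refl)) = adj-sym uv
        ... | no _                     = colour⇒adj P eq

        colour′-injective : colour′ y z ≡ just c → colour′ y w ≡ just c → z ≡ w
        colour′-injective {y} {z} {c} {w} yz yw with isUV? y z | isUV? y w
        ... | no _ | no _ = colour-injective P yz yw
        ... | yes yz-uv | no _ with refl ← yz = contradiction yw (isUV⇒misses {y} yz-uv w)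
        ... | no _ | yes yw-uv with refl ← yw = contradiction yz (isUV⇒misses {y} yw-uv z)
        ... | yes (inj₁ (_ , refl)) | yes (inj₁ (_ , refl)) = refl
        ... | yes (inj₂ (_ , refl)) | yes (inj₂ (_ , refl)) = refl
        ... | yes (inj₁ (refl , _)) | yes (inj₂ (y≡v , _)) = contradiction y≡v (adj⇒≢ uv)
        ... | yes (inj₂ (refl , _)) | yes (inj₁ (y≡u , _)) = contradiction (sym y≡u) (adj⇒≢ uv)

        extended : PartialColouring
        extended = record
          { colour           = colour′
          ; colour-sym       = colour′-sym
          ; colour⇒adj       = λ {y} {z} → colour′⇒adj {y} {z}
          ; colour-injective = λ {y} → colour′-injective {y}
          }

        extended-⊒ : P ⊑ extended
        extended-⊒ {y} {z} yz with isUV? y z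
        ... | yes _ = a , refl
        ... | no _  = yz

        extended-uv : Coloured extended u v
        extended-uv with isUV? u v
        ... | yes _  = a , refl
        ... | no ¬uv = contradiction (inj₁ (refl , refl)) ¬uv

      extend : Extension P u v
      extend = extended , extended-⊒ , extended-uv

    module KempeSwap (P : PartialColouring) (a b : Fin K) {S : Vertex → Set} (S? : ∀ y → Dec (S y))
                     (S-closed : ∀ {y z c} → S y → colour P y z ≡ just c → c ≡ a ⊎ c ≡ b → S z) where
      private
        σ : Fin K → Fin K
        σ = transpose a b

        map-σ-just : ∀ m → Maybe.map σ m ≡ just c → ∃[ d ] m ≡ just d × σ d ≡ c
        map-σ-just (just d) eq = d , refl , just-injective eq

        σ-fixes-leaving : S y → ¬ S z → Maybe.map σ (colour P y z) ≡ colour P y z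
        σ-fixes-leaving {y} {z} y∈S z∉S with colour P y z in yz
        ... | nothing = refl
        ... | just c  = cong just (transpose-fix (z∉S ∘ S-closed y∈S yz ∘ inj₁) (z∉S ∘ S-closed y∈S yz ∘ inj₂))

        colour′ : Vertex → Vertex → Maybe (Fin K)
        colour′ y z with S? y
        ... | yes _ = Maybe.map σ (colour P y z)
        ... | no _  = colour P y z

        colour′-sym : ∀ y z → colour′ y z ≡ colour′ z y
        colour′-sym y z with S? y | S? z
        ... | yes _   | yes _   = cong (Maybe.map σ) (colour-sym P y z)
        ... | no _    | no _    = colour-sym P y z
        ... | yes y∈S | no z∉S  = trans (σ-fixes-leaving y∈S z∉S) (colour-sym P y z)
        ... | no y∉S  | yes z∈S = trans (colour-sym P y z) (sym (σ-fixes-leaving z∈S y∉S))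

        colour′⇒adj : colour′ y z ≡ just c → Adj y z
        colour′⇒adj {y} {z} {c} eq with S? y
        ... | yes _ = colour⇒adj P (proj₁ (proj₂ (map-σ-just (colour P y z) eq)))
        ... | no _  = colour⇒adj P eq

        colour′-injective : colour′ y z ≡ just c → colour′ y w ≡ just c → z ≡ w
        colour′-injective {y} {z} {c} {w} yz yw with S? y
        ... | no _ = colour-injective P yz yw
        ... | yes _ with map-σ-just (colour P y z) yz | map-σ-just (colour P y w) yw
        ...   | d , yz′ , σd≡c | e , yw′ , σe≡c with refl ← transpose-injective a b {d} {e} (trans σd≡c (sym σe≡c))
          = colour-injective P yz′ yw′

      swapped : PartialColouring
      swapped = record
        { colour           = colour′
        ; colour-sym       = colour′-sym
        ; colour⇒adj       = λ {y} {z} → colour′⇒adj {y} {z}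
        ; colour-injective = λ {y} → colour′-injective {y}
        }

      swapped-⊒ : P ⊑ swapped
      swapped-⊒ {y} {z} (c , yz) with S? y
      ... | yes _ = σ c , cong (Maybe.map σ) yz
      ... | no _  = c , yz

      swapped-inside : S y → Missing P y b → Missing swapped y a
      swapped-inside {y} y∈S y-misses-b w yw with S? y
      ... | no y∉S = y∉S y∈S
      ... | yes _ with map-σ-just (colour P y w) yw
      ...   | d , yw′ , σd≡a = y-misses-b w (trans yw′ (cong just (transpose[l]≡i⇒l≡j σd≡a)))

      swapped-outside : ¬ S y → Missing P y c → Missing swapped y c
      swapped-outside {y} y∉S y-misses w yw with S? y
      ... | yes y∈S = y∉S y∈S
      ... | no _    = y-misses w yw

    module AlternatingPath (P : PartialColouring) (side : Vertex → Bool)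
                           (bipartite : ∀ y z → Adj y z → side y ≢ side z)
                           (v : Vertex) (a b : Fin K) (v-misses-b : Missing P v b) where

      across : Vertex → Bool
      across y = side y xor side v

      across-start : across v ≡ false
      across-start = xor-same (side v)

      across-adj : Adj y z → across y ≡ not (across z)
      across-adj {y} {z} yz = begin
        side y xor side v       ≡⟨ cong (_xor side v) (¬-not (bipartite y z yz)) ⟩
        not (side z) xor side v ≡⟨ sym (not-distribˡ-xor (side z) (side v)) ⟩
        not (side z xor side v) ∎
        where open ≡-Reasoning

      colourOf : Bool → Fin K
      colourOf false = a
      colourOf true  = b

      colourOf-other : ∀ s → c ≡ a ⊎ c ≡ b → c ≢ colourOf s → c ≡ colourOf (not s)
      colourOf-other false (inj₁ c≡a) c≢a = contradiction c≡a c≢a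
      colourOf-other false (inj₂ c≡b) _   = c≡b
      colourOf-other true  (inj₁ c≡a) _   = c≡a
      colourOf-other true  (inj₂ c≡b) c≢b = contradiction c≡b c≢b

      -- Along the path from v both the colours (a, b, a, …) and the sides of the bipartition
      -- alternate, so the colour by which the path leaves y is read off the side of y.
      colourAt : Vertex → Fin K
      colourAt y = colourOf (across y)

      colourAt-adj : Adj y z → colourAt y ≡ colourOf (not (across z))
      colourAt-adj yz = cong colourOf (across-adj yz)

      walk : ℕ → Maybe Vertex
      walk zero    = just v
      walk (suc i) = walk i >>= λ y → colourNeighbour P y (colourAt y)

      walk-step : ∀ i → walk (suc i) ≡ just z → ∃[ y ] walk i ≡ just y × colour P y z ≡ just (colourAt y)
      walk-step i eq with walk i
      ... | just y = y , refl , colourNeighbour-sound eq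

      walk-next : ∀ i → walk i ≡ just y → colour P y z ≡ just (colourAt y) → walk (suc i) ≡ just z
      walk-next i eq yz rewrite eq = colourNeighbour-complete yz

      walk-entry : ∀ i → walk (suc i) ≡ just z → ∃[ y ] walk i ≡ just y × colour P z y ≡ just (colourOf (not (across z)))
      walk-entry i eq with y , wy , yz ← walk-step i eq =
        y , wy , trans (colour-sym P _ y) (trans yz (cong just (colourAt-adj (colour⇒adj P yz))))

      walk-never-returns : ∀ i → walk (suc i) ≢ just v
      walk-never-returns i eq with y , _ , vy ← walk-entry i eq =
        v-misses-b y (trans vy (cong (just ∘ colourOf ∘ not) across-start))

      walk-injective : ∀ i j → walk i ≡ just y → walk j ≡ just y → i ≡ j
      walk-injective zero    zero    _  _    = refl
      walk-injective zero    (suc j) refl e  = contradiction e (walk-never-returns j)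
      walk-injective (suc i) zero    e  refl = contradiction e (walk-never-returns i)
      walk-injective (suc i) (suc j) e₁ e₂
        with y₁ , w₁ , yy₁ ← walk-entry i e₁ | y₂ , w₂ , yy₂ ← walk-entry j e₂
        with refl ← colour-injective P yy₁ yy₂ = cong suc (walk-injective i j w₁ w₂)

      walk-prefix : ∀ {i j} → j ≤′ i → walk i ≡ just y → ∃[ x ] walk j ≡ just x
      walk-prefix ≤′-refl          eq = _ , eq
      walk-prefix (≤′-step {i} j≤i) eq = walk-prefix j≤i (proj₁ (proj₂ (walk-step i eq)))

      walk-bound : ∀ i → walk i ≡ just y → i < n G
      walk-bound i eq = injective⇒≤ visited-injective
        where
          visited : Fin (suc i) → Vertex
          visited k = proj₁ (walk-prefix (≤⇒≤′ (toℕ≤pred[n] k)) eq)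

          walk-visited : ∀ k → walk (toℕ k) ≡ just (visited k)
          walk-visited k = proj₂ (walk-prefix (≤⇒≤′ (toℕ≤pred[n] k)) eq)

          visited-injective : Injective _≡_ _≡_ visited
          visited-injective {k} {l} eq′ =
            toℕ-injective (walk-injective (toℕ k) (toℕ l) (walk-visited k) (trans (walk-visited l) (cong just (sym eq′))))

      OnPath : Vertex → Set
      OnPath y = ∃[ i ] walk i ≡ just y

      onPath? : ∀ y → Dec (OnPath y)
      onPath? y = map′ (λ (k , eq) → toℕ k , eq) bounded (any? λ k → walk (toℕ k) ≟ᵛ just y)
        where
          _≟ᵛ_ : (x y : Maybe Vertex) → Dec (x ≡ y)
          _≟ᵛ_ = ≡-dec _≟_

          bounded : OnPath y → ∃[ k ] walk (toℕ k) ≡ just y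
          bounded (i , eq) =
            fromℕ< (walk-bound i eq) , subst (λ j → walk j ≡ just y) (sym (toℕ-fromℕ< (walk-bound i eq))) eq

      onPath-start : OnPath v
      onPath-start = 0 , refl

      walk-back : ∀ i → walk i ≡ just y → colour P y z ≡ just (colourOf (not (across y))) → OnPath z
      walk-back zero    refl vz = contradiction (trans vz (cong (just ∘ colourOf ∘ not) across-start)) (v-misses-b _)
      walk-back (suc i) eq   yz with x , wx , yx ← walk-entry i eq with refl ← colour-injective P yz yx = i , wx

      onPath-closed : OnPath y → colour P y z ≡ just c → c ≡ a ⊎ c ≡ b → OnPath z
      onPath-closed {y} {z} {c} (i , eq) yz c∈ab with c ≟ colourAt y
      ... | yes refl = suc i , walk-next i eq yz
      ... | no c≢    = walk-back i eq (trans yz (cong just (colourOf-other (across y) c∈ab c≢)))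

      onPath-across⇒a-edge : OnPath y → across y ≡ true → ∃[ z ] colour P y z ≡ just a
      onPath-across⇒a-edge (zero , refl) v-across = contradiction (trans (sym across-start) v-across) λ ()
      onPath-across⇒a-edge (suc i , eq) y-across with x , _ , yx ← walk-entry i eq =
        x , trans yx (cong (just ∘ colourOf ∘ not) y-across)

    module _ (side : Vertex → Bool) (bipartite : ∀ y z → Adj y z → side y ≢ side z)
             (degree≤K : ∀ x → degree G x ≤ K) where

      colourEdge : (P : PartialColouring) → Adj u v → Extension P u v
      colourEdge {u} {v} P uv with colour P u v in uv-colour
      ... | just c = P , id , c , uv-colour
      ... | nothing
        with a , u-misses-a ← missing-colour P (degree≤K u) uv uv-colour
           | b , v-misses-b ← missing-colour P (degree≤K v) (adj-sym uv) (trans (colour-sym P v u) uv-colour)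
        with a ≟ b
      ... | yes refl = extend P uv u-misses-a v-misses-b
      ... | no _ = let Q , Q⊒ , Q-uv = extend swapped uv u-misses-a′ v-misses-a′ in Q , Q⊒ ∘ swapped-⊒ , Q-uv
        where
          open AlternatingPath P side bipartite v a b v-misses-b
          open KempeSwap P a b onPath? onPath-closed

          u∉path : ¬ OnPath u
          u∉path u∈path =
            let z , uz = onPath-across⇒a-edge u∈path (trans (across-adj uv) (cong not across-start))
            in u-misses-a z uz

          u-misses-a′ : Missing swapped u a
          u-misses-a′ = swapped-outside u∉path u-misses-a

          v-misses-a′ : Missing swapped v a
          v-misses-a′ = swapped-inside onPath-start v-misses-b

      colourAll : (P : PartialColouring) (L : List (Vertex × Vertex)) →
                  Σ PartialColouring λ Q → P ⊑ Q × (∀ {y z} → (y , z) ∈ L → Adj y z → Coloured Q y z)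
      colourAll P [] = P , id , λ ()
      colourAll P ((u , v) ∷ L) with adjacent? u v
      ... | no ¬uv =
            let Q , P⊑Q , Q-L = colourAll P L
            in Q , P⊑Q , λ { (here refl) uv → contradiction uv ¬uv ; (there yz∈L) → Q-L yz∈L }
      ... | yes uv =
            let P′ , P⊑P′ , P′-uv = colourEdge P uv
                Q , P′⊑Q , Q-L = colourAll P′ L
            in Q , P′⊑Q ∘ P⊑P′ , λ { (here refl) _ → P′⊑Q P′-uv ; (there yz∈L) → Q-L yz∈L }

      kőnig : Σ PartialColouring Total
      kőnig =
        let Q , _ , Q-all = colourAll uncoloured (cartesianProduct (allFin (n G)) (allFin (n G)))
        in Q , λ {y} {z} → Q-all (∈-cartesianProductWith⁺ _,_ (∈-allFin y) (∈-allFin z))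

    -- The upper bound

    module _ (side : Vertex → Bool) (bipartite : ∀ y z → Adj y z → side y ≢ side z)
             (P : PartialColouring) (total : Total P) where

      incidenceColouring : Incidence G → Fin (2 * K)
      incidenceColouring ((v , w) , vw) = combine (fromBool (side v)) (proj₁ (total vw))

      incidenceColouring-conflictFree : IsCFIncColoring G (2 * K) incidenceColouring
      incidenceColouring-conflictFree ((v , w) , vw) ((v′ , w′) , v′w′) distinct (x , x∈vw , x∈v′w′) same
        with same-side , same-colour ← combine-injective (fromBool (side v)) _ (fromBool (side v′)) _ same
        = shared-endpoint x∈vw x∈v′w′
        where
          vw-c : colour P v w ≡ just (proj₁ (total vw))
          vw-c = proj₂ (total vw)

          v′w′-c : colour P v′ w′ ≡ just (proj₁ (total vw))
          v′w′-c = trans (proj₂ (total v′w′)) (cong just (sym same-colour))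

          shared-endpoint : x ≡ v ⊎ x ≡ w → x ≡ v′ ⊎ x ≡ w′ → ⊥
          shared-endpoint (inj₁ refl) (inj₁ refl) =
            distinct (cong (v ,_) (colour-injective P vw-c v′w′-c))
          shared-endpoint (inj₁ refl) (inj₂ refl)
            with refl ← colour-injective P vw-c (trans (colour-sym P v v′) v′w′-c) =
            bipartite v w vw (fromBool-injective same-side)
          shared-endpoint (inj₂ refl) (inj₁ refl)
            with refl ← colour-injective P (trans (colour-sym P w v) vw-c) v′w′-c =
            bipartite v w vw (fromBool-injective same-side)
          shared-endpoint (inj₂ refl) (inj₂ refl) =
            distinct (cong (_, w) (colour-injective P (trans (colour-sym P w v) vw-c) (trans (colour-sym P w v′) v′w′-c)))

theorem2p4 : (G : Graph) → Bipartite G → ChiCI≡ G (2 * Δ G)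
theorem2p4 G (side , bipartite) =
  (incidenceColouring side bipartite P total , incidenceColouring-conflictFree side bipartite P total) ,
  λ k c cf → conflictFree⇒2*Δ≤ G c cf
  where
    open EdgeColouring G (Δ G)

    edgeColouring : Σ PartialColouring Total
    edgeColouring = kőnig side bipartite (degree≤Δ G)

    P : PartialColouring
    P = proj₁ edgeColouring

    total : Total P
    total = proj₂ edgeColouring
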